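{- Let $D$ be a set of integers with $-1\notin D$, and let $(T,s)$ be a signed tree that realizes $D$. If $v$ is a vertex of $T$ with $sdeg(v)<0$, then $v$ is not a pendant vertex and $v$ is not adjacent to a limiting pendant vertex of $T$.
   Context: A signed tree is a pair $(T,s)$ with $T$ a finite tree and $s:E(T)\to\{+,-\}$. The signed degree $sdeg(v)$ of a vertex is the number of incident positive edges minus the number of incident negative edges. $(T,s)$ realizes $D$ if $D=\{sdeg(v):v\in V(T)\}$. A pendant vertex is a vertex of degree $1$. A limiting pendant vertex of a tree $T$ is a vertex that is an endpoint (pendant vertex) of some longest path of $T$. -}

module Defs where

open import Data.Nat using (ℕ; zero; suc; _≤_; _≥_)
open import Data.Integer using (ℤ; +_; -_; _+_; -1ℤ; 0ℤ; 1ℤ)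
open import Data.Fin using (Fin)
open import Data.List using (List; []; _∷_; length; head; last; foldr; map; filter)
open import Data.List.Relation.Unary.Linked using (Linked)
open import Data.List.Relation.Unary.Unique.Propositional using (Unique)
open import Data.Maybe using (Maybe; just; nothing; is-just)
open import Data.Bool using (Bool; true; false; T)
open import Data.Vec.Functional using ()
open import Data.List using (allFin)
open import Data.Product using (Σ; ∃; _×_; _,_)
open import Data.Sum using (_⊎_)
open import Data.Empty using (⊥)
open import Relation.Binary.PropositionalEquality using (_≡_)
open import Relation.Nullary using (¬_)

data Sign : Set where
  pos neg : Sign

signVal : Sign → ℤ
signVal pos = 1ℤ
signVal neg = -1ℤ

-- A finite simple signed graph on vertex set Fin n:
-- sgn u v = just s  iff  {u,v} is an edge with sign s; nothing iff not an edge.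
record SignedGraph (n : ℕ) : Set where
  field
    sgn       : Fin n → Fin n → Maybe Sign
    symmetric : ∀ u v → sgn u v ≡ sgn v u
    loopless  : ∀ v → sgn v v ≡ nothing
open SignedGraph public

module _ {n : ℕ} (G : SignedGraph n) where

  Adj : Fin n → Fin n → Set
  Adj u v = ∃ λ s → sgn G u v ≡ just s

  deg : Fin n → ℕ
  deg v = length (filter (λ u → Data.Maybe.is-just (sgn G v u) Data.Bool.≟ true) (allFin n))

  edgeVal : Maybe Sign → ℤ
  edgeVal nothing  = 0ℤ
  edgeVal (just s) = signVal s

  sdeg : Fin n → ℤ
  sdeg v = foldr _+_ 0ℤ (map (λ u → edgeVal (sgn G v u)) (allFin n))

  Pendant : Fin n → Set
  Pendant v = deg v ≡ 1

  IsWalk : List (Fin n) → Set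
  IsWalk [] = ⊥
  IsWalk (x ∷ xs) = Linked Adj (x ∷ xs)

  IsPath : List (Fin n) → Set
  IsPath p = IsWalk p × Unique p

  IsCycle : List (Fin n) → Set
  IsCycle [] = ⊥
  IsCycle (x ∷ xs) = IsPath (x ∷ xs) × length (x ∷ xs) ≥ 3 × (∀ y → last (x ∷ xs) ≡ just y → Adj y x)

  Connected : Set
  Connected = ∀ u v → ∃ λ p → IsPath p × head p ≡ just u × last p ≡ just v

  Acyclic : Set
  Acyclic = ∀ c → ¬ IsCycle c

  IsTree : Set
  IsTree = Connected × Acyclic

  -- a longest path (lengths compared by number of vertices = number of edges + 1)
  IsLongestPath : List (Fin n) → Set
  IsLongestPath p = IsPath p × (∀ q → IsPath q → length q ≤ length p)

  LimitingPendant : Fin n → Set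
  LimitingPendant w = ∃ λ p → IsLongestPath p × (head p ≡ just w ⊎ last p ≡ just w)

  Realizes : (ℤ → Set) → Set
  Realizes D = ∀ z → (D z → ∃ λ v → sdeg v ≡ z) × ((∃ λ v → sdeg v ≡ z) → D z)

{-# OPTIONS --safe #-}
module Submission where

-- A pendant vertex has signed degree ±1, so one of negative signed degree would put -1 in D.
-- For the second claim let w, v, … be a longest path starting at a limiting pendant vertex w.
-- In a tree, every neighbour u of v other than the third vertex of the path can replace w,
-- giving another longest path; hence u is a leaf hanging from v, sdeg u is the sign of the
-- edge uv, and that sign must be + because -1 ∉ D. So v has at most one negative edge (to the
-- third vertex) and at least one positive edge (to w), and sdeg v ≥ 0.

open import Defs
open import Function using (_∘_)
open import Data.Nat using (ℕ; _≤_; z≤n; s≤s)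
import Data.Nat.Properties as ℕ
open import Data.Integer using (ℤ; _+_; _<_; 0ℤ; 1ℤ; -1ℤ; +≤+; -≤+)
  renaming (_≤_ to _≤ℤ_; _<?_ to _<ℤ?_)
import Data.Integer.Properties as ℤ
open import Data.Fin using (Fin; _≟_)
open import Data.Maybe using (just; nothing; is-just)
open import Data.Maybe.Properties using (just-injective)
import Data.Maybe.Properties as Maybe
open import Data.Bool using (true)
import Data.Bool as Bool
open import Data.Product using (_×_; _,_; ∃; proj₂)
open import Data.Sum using (_⊎_; inj₁; inj₂)
open import Data.Empty using (⊥-elim)
open import Data.List using (List; []; _∷_; _++_; [_]; length; head; last; foldr; map; filter;
  allFin; reverse; _ʳ++_)
open import Data.List.Properties using (length-reverse; length-++; ++-assoc)
open import Data.List.Relation.Unary.Linked using (Linked; []; [-]; _∷_)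
open import Data.List.Relation.Unary.All using (All; []; _∷_)
import Data.List.Relation.Unary.All as All
open import Data.List.Relation.Unary.All.Properties using (¬Any⇒All¬; ++⁻ˡ)
open import Data.List.Relation.Unary.AllPairs using (AllPairs; []; _∷_)
open import Data.List.Relation.Unary.Unique.Propositional using (Unique)
open import Data.List.Relation.Unary.Unique.Propositional.Properties using (allFin⁺)
open import Data.List.Relation.Unary.Any using (here; there)
open import Data.List.Membership.Propositional using (_∈_)
open import Data.List.Membership.Propositional.Properties using (∈-allFin; ∈-∃++)
open import Data.List.Relation.Binary.Permutation.Propositional using (↭-sym; ↭⇒↭ₛ)
open import Data.List.Relation.Binary.Permutation.Propositional.Properties using (↭-reverse)
import Data.List.Relation.Binary.Permutation.Setoid.Properties as Permutationₛ
open import Relation.Binary.Definitions using (Symmetric)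
open import Relation.Binary.PropositionalEquality
  using (_≡_; _≢_; refl; sym; trans; cong; subst; setoid)
open import Relation.Nullary using (¬_; yes; no)
open import Relation.Nullary.Decidable using (decidable-stable)

module _ {A : Set} where

  Linked-++⁻ˡ : ∀ {R : A → A → Set} xs {ys} → Linked R (xs ++ ys) → Linked R xs
  Linked-++⁻ˡ []           _         = []
  Linked-++⁻ˡ (x ∷ [])     _         = [-]
  Linked-++⁻ˡ (x ∷ y ∷ xs) (r ∷ rs) = r ∷ Linked-++⁻ˡ (y ∷ xs) rs

  AllPairs-++⁻ˡ : ∀ {R : A → A → Set} xs {ys} → AllPairs R (xs ++ ys) → AllPairs R xs
  AllPairs-++⁻ˡ []       _          = []
  AllPairs-++⁻ˡ (x ∷ xs) (rs ∷ rss) = ++⁻ˡ xs rs ∷ AllPairs-++⁻ˡ xs rss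

  last-∷ʳ : ∀ xs {x : A} → last (xs ++ [ x ]) ≡ just x
  last-∷ʳ []           = refl
  last-∷ʳ (y ∷ [])     = refl
  last-∷ʳ (y ∷ z ∷ xs) = last-∷ʳ (z ∷ xs)

  Linked-ʳ++ : ∀ {R : A → A → Set} → Symmetric R →
               ∀ {x} xs {acc} → Linked R (x ∷ xs) → Linked R (x ∷ acc) → Linked R ((x ∷ xs) ʳ++ acc)
  Linked-ʳ++ R-sym []       _        racc = racc
  Linked-ʳ++ R-sym (y ∷ ys) (r ∷ rs) racc = Linked-ʳ++ R-sym ys rs (R-sym r ∷ racc)

  Linked-reverse : ∀ {R : A → A → Set} → Symmetric R → ∀ {xs} → Linked R xs → Linked R (reverse xs)
  Linked-reverse R-sym {[]}     _  = []
  Linked-reverse R-sym {x ∷ xs} rs = Linked-ʳ++ R-sym xs rs [-]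

  head-ʳ++ : ∀ xs {acc} {w : A} → last xs ≡ just w → head (xs ʳ++ acc) ≡ just w
  head-ʳ++ (x ∷ [])     e = e
  head-ʳ++ (x ∷ y ∷ xs) e = head-ʳ++ (y ∷ xs) e

  head⇒∈ : ∀ {xs} {x : A} → head xs ≡ just x → x ∈ xs
  head⇒∈ {_ ∷ _} refl = here refl

  head-reverse : ∀ xs {w : A} → last xs ≡ just w → head (reverse xs) ≡ just w
  head-reverse xs = head-ʳ++ xs

  Unique-reverse : ∀ xs → Unique xs → Unique (reverse xs)
  Unique-reverse xs = Permutationₛ.Unique-resp-↭ (setoid A) (↭⇒↭ₛ (↭-sym (↭-reverse xs)))

∑ : {A : Set} → (A → ℤ) → List A → ℤ
∑ f l = foldr _+_ 0ℤ (map f l)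

module _ {A : Set} (f : A → ℤ) where

  ∑-vanishing-off : ∀ {v l} → Unique l → v ∈ l → (∀ t → t ≢ v → f t ≡ 0ℤ) → ∑ f l ≡ f v
  ∑-vanishing-off {l = x ∷ xs} (x≢xs ∷ _) (here refl) f≡0 =
    trans (cong (f x +_) (∑-zero xs (All.map (f≡0 _ ∘ (_∘ sym)) x≢xs))) (ℤ.+-identityʳ (f x))
    where
    ∑-zero : ∀ ys → All (λ t → f t ≡ 0ℤ) ys → ∑ f ys ≡ 0ℤ
    ∑-zero []       []         = refl
    ∑-zero (y ∷ ys) (fy≡0 ∷ z) rewrite fy≡0 = trans (ℤ.+-identityˡ _) (∑-zero ys z)
  ∑-vanishing-off {l = x ∷ xs} (x≢xs ∷ u) (there v∈xs) f≡0
    rewrite f≡0 x (All.lookup x≢xs v∈xs) = trans (ℤ.+-identityˡ _) (∑-vanishing-off u v∈xs f≡0)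

  ∑-nonneg : ∀ {l} → All (λ t → 0ℤ ≤ℤ f t) l → 0ℤ ≤ℤ ∑ f l
  ∑-nonneg []       = ℤ.≤-refl
  ∑-nonneg (p ∷ ps) = ℤ.+-mono-≤ p (∑-nonneg ps)

  ∑-positive : ∀ {l w} → All (λ t → 0ℤ ≤ℤ f t) l → w ∈ l → 1ℤ ≤ℤ f w → 1ℤ ≤ℤ ∑ f l
  ∑-positive (_ ∷ ps) (here refl) fw≥1 = ℤ.+-mono-≤ fw≥1 (∑-nonneg ps)
  ∑-positive (p ∷ ps) (there w∈l) fw≥1 = ℤ.+-mono-≤ p (∑-positive ps w∈l fw≥1)

  module _ (f≥-1 : ∀ t → -1ℤ ≤ℤ f t) (one-negative : ∀ {s t} → f s < 0ℤ → f t < 0ℤ → s ≡ t) where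

    others-nonneg : ∀ {y ys} → f y < 0ℤ → All (y ≢_) ys → All (λ t → 0ℤ ≤ℤ f t) ys
    others-nonneg fy<0 = All.map (λ y≢t → ℤ.≮⇒≥ (y≢t ∘ one-negative fy<0))

    ∑-≥-1 : ∀ {l} → Unique l → -1ℤ ≤ℤ ∑ f l
    ∑-≥-1 {[]}     _        = -≤+
    ∑-≥-1 {y ∷ ys} (y≢ys ∷ u) with f y <ℤ? 0ℤ
    ... | yes fy<0 = ℤ.+-mono-≤ (f≥-1 y) (∑-nonneg (others-nonneg fy<0 y≢ys))
    ... | no  fy≮0 = ℤ.+-mono-≤ (ℤ.≮⇒≥ fy≮0) (∑-≥-1 u)

    ∑-nonneg-by-positive : ∀ {l w} → Unique l → w ∈ l → 1ℤ ≤ℤ f w → 0ℤ ≤ℤ ∑ f l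
    ∑-nonneg-by-positive (_ ∷ u) (here refl) fw≥1 = ℤ.+-mono-≤ fw≥1 (∑-≥-1 u)
    ∑-nonneg-by-positive {y ∷ _} (y≢ys ∷ u) (there w∈ys) fw≥1 with f y <ℤ? 0ℤ
    ... | yes fy<0 = ℤ.+-mono-≤ (f≥-1 y) (∑-positive (others-nonneg fy<0 y≢ys) w∈ys fw≥1)
    ... | no  fy≮0 = ℤ.+-mono-≤ (ℤ.≮⇒≥ fy≮0) (∑-nonneg-by-positive u w∈ys fw≥1)

module _ {n : ℕ} (G : SignedGraph n) where

  Adj-sym : ∀ {u v} → Adj G u v → Adj G v u
  Adj-sym {u} {v} (s , e) = s , trans (symmetric G v u) e

  Adj-irrefl : ∀ {u v} → Adj G u v → u ≢ v
  Adj-irrefl {u} (s , e) refl with trans (sym (loopless G u)) e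
  ... | ()

  -- sdeg G v unfolds to ∑ (incidence v) (allFin n), and deg G v to degIn v (allFin n).
  incidence : Fin n → Fin n → ℤ
  incidence v u = edgeVal G (sgn G v u)

  incidence-≥-1 : ∀ v u → -1ℤ ≤ℤ incidence v u
  incidence-≥-1 v u with sgn G v u
  ... | nothing   = -≤+
  ... | just pos  = -≤+
  ... | just neg  = ℤ.≤-refl

  incidence<0⇒non-positive-edge : ∀ {v u} → incidence v u < 0ℤ → Adj G v u × sgn G v u ≢ just pos
  incidence<0⇒non-positive-edge {v} {u} lt with sgn G v u
  ... | just neg = (neg , refl) , λ ()
  ... | nothing  = ⊥-elim (ℤ.<-irrefl refl lt)
  ... | just pos = ⊥-elim (ℤ.<⇒≱ lt (+≤+ z≤n))

  degIn : Fin n → List (Fin n) → ℕ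
  degIn v l = length (filter (λ u → is-just (sgn G v u) Bool.≟ true) l)

  ∑-incidence-deg0 : ∀ v l → degIn v l ≡ 0 → ∑ (incidence v) l ≡ 0ℤ
  ∑-incidence-deg0 v []       _ = refl
  ∑-incidence-deg0 v (u ∷ l) d with sgn G v u
  ... | nothing = trans (ℤ.+-identityˡ _) (∑-incidence-deg0 v l d)

  ∑-incidence-deg1 : ∀ v l → degIn v l ≡ 1 → ∑ (incidence v) l ≡ 1ℤ ⊎ ∑ (incidence v) l ≡ -1ℤ
  ∑-incidence-deg1 v (u ∷ l) d with sgn G v u
  ... | nothing  rewrite ℤ.+-identityˡ (∑ (incidence v) l) = ∑-incidence-deg1 v l d
  ... | just pos rewrite ∑-incidence-deg0 v l (ℕ.suc-injective d) = inj₁ refl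
  ... | just neg rewrite ∑-incidence-deg0 v l (ℕ.suc-injective d) = inj₂ refl

  sdeg-pendant : ∀ {v} → Pendant G v → sdeg G v ≡ 1ℤ ⊎ sdeg G v ≡ -1ℤ
  sdeg-pendant {v} = ∑-incidence-deg1 v (allFin n)

  LeafOf : Fin n → Fin n → Set
  LeafOf v u = ∀ t → Adj G u t → t ≡ v

  sdeg-leaf : ∀ {u v} → LeafOf v u → sdeg G u ≡ incidence u v
  sdeg-leaf {u} {v} leaf = ∑-vanishing-off (incidence u) (allFin⁺ n) (∈-allFin v) off-v
    where
    off-v : ∀ t → t ≢ v → incidence u t ≡ 0ℤ
    off-v t t≢v with sgn G u t in e
    ... | nothing = refl
    ... | just s  = ⊥-elim (t≢v (leaf t (s , e)))

  longestPath-from : ∀ {w} → LimitingPendant G w → ∃ λ q → IsLongestPath G (w ∷ q)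
  longestPath-from (_ ∷ q , lp , inj₁ refl) = q , lp
  longestPath-from (p@(_ ∷ _) , ((walk , unique) , longest) , inj₂ last≡w)
    with reverse p | head-reverse p last≡w | Linked-reverse Adj-sym walk
       | Unique-reverse p unique | length-reverse p
  ... | _ ∷ q | refl | walk′ | unique′ | len =
    q , (walk′ , unique′) , λ q′ path → subst (length q′ ≤_) (sym len) (longest q′ path)

  module _ (acyclic : Acyclic G) where

    -- A later vertex b adjacent to a would close the cycle a, …, b.
    path-chord : ∀ {a q b} → IsPath G (a ∷ q) → b ∈ q → Adj G a b → head q ≡ just b
    path-chord {a} {b = b} (walk , unique) b∈q a~b with ∈-∃++ b∈q
    ... | [] , zs , refl = refl
    ... | y ∷ ys , zs , refl = ⊥-elim (acyclic cycle (path , length≥3 , closes))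
      where
      cycle : List (Fin n)
      cycle = a ∷ y ∷ ys ++ [ b ]
      split : a ∷ y ∷ ys ++ [ b ] ++ zs ≡ cycle ++ zs
      split = cong (λ l → a ∷ y ∷ l) (sym (++-assoc ys [ b ] zs))
      path : IsPath G cycle
      path = Linked-++⁻ˡ cycle (subst (Linked (Adj G)) split walk)
           , AllPairs-++⁻ˡ cycle (subst Unique split unique)
      length≥3 : 3 ≤ length cycle
      length≥3 = s≤s (s≤s (subst (1 ≤_) (sym (length-++ ys)) (ℕ.m≤n+m 1 (length ys))))
      closes : ∀ c → last cycle ≡ just c → Adj G c a
      closes c e with trans (sym (last-∷ʳ (a ∷ y ∷ ys))) e
      ... | refl = Adj-sym a~b

    neighbour-off-path : ∀ {a q t} → IsPath G (a ∷ q) → Adj G a t → ¬ head q ≡ just t → All (t ≢_) (a ∷ q)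
    neighbour-off-path {q = q} path a~t t≢next =
      Adj-irrefl (Adj-sym a~t) ∷ ¬Any⇒All¬ q (t≢next ∘ λ t∈q → path-chord path t∈q a~t)

    longestPath-neighbour : ∀ {a q t} → IsLongestPath G (a ∷ q) → Adj G a t → head q ≡ just t
    longestPath-neighbour {a} {q} {t} (path@(walk , unique) , longest) a~t =
      decidable-stable (Maybe.≡-dec _≟_ (head q) (just t)) λ t≢next →
        ℕ.1+n≰n (longest (t ∷ a ∷ q) ((Adj-sym a~t ∷ walk) , (neighbour-off-path path a~t t≢next ∷ unique)))

    longestPath-head-leaf : ∀ {u v r} → IsLongestPath G (u ∷ v ∷ r) → LeafOf v u
    longestPath-head-leaf lp t u~t = sym (just-injective (longestPath-neighbour lp u~t))

    -- Any neighbour u of v other than the third vertex can replace w at the start of the path.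
    longestPath-second-neighbour-leaf : ∀ {w v r u} → IsLongestPath G (w ∷ v ∷ r) →
                                        Adj G v u → ¬ head r ≡ just u → LeafOf v u
    longestPath-second-neighbour-leaf ((_ ∷ walk , _ ∷ unique) , longest) v~u u≢next =
      longestPath-head-leaf
        ((Adj-sym v~u ∷ walk , neighbour-off-path (walk , unique) v~u u≢next ∷ unique) , longest)

  module _ (D : ℤ → Set) (-1∉D : ¬ D -1ℤ) (realizes : Realizes G D) where

    sdeg≢-1 : ∀ u → sdeg G u ≢ -1ℤ
    sdeg≢-1 u e = -1∉D (proj₂ (realizes -1ℤ) (u , e))

    leaf-edge-positive : ∀ {u v} → LeafOf v u → Adj G v u → sgn G v u ≡ just pos
    leaf-edge-positive leaf (pos , e) = e
    leaf-edge-positive {u} {v} leaf (neg , e) =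
      ⊥-elim (sdeg≢-1 u (trans (sdeg-leaf leaf) (cong (edgeVal G) (trans (symmetric G u v) e))))

    module _ (acyclic : Acyclic G) where

      longestPath-second-sdeg-nonneg : ∀ {w v r} → IsLongestPath G (w ∷ v ∷ r) → 0ℤ ≤ℤ sdeg G v
      longestPath-second-sdeg-nonneg {w} {v} {r} lp@(((w~v ∷ _) , (w≢vr ∷ _)) , _) =
        ∑-nonneg-by-positive (incidence v) (incidence-≥-1 v) one-negative
          (allFin⁺ n) (∈-allFin w) (ℤ.≤-reflexive (sym (cong (edgeVal G) positive-to-w)))
        where
        positive-off-spine : ∀ {u} → Adj G v u → ¬ head r ≡ just u → sgn G v u ≡ just pos
        positive-off-spine v~u u≢next =
          leaf-edge-positive (longestPath-second-neighbour-leaf acyclic lp v~u u≢next) v~u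
        negative-to-next : ∀ {u} → incidence v u < 0ℤ → head r ≡ just u
        negative-to-next {u} lt with incidence<0⇒non-positive-edge lt
        ... | v~u , non-positive = decidable-stable (Maybe.≡-dec _≟_ (head r) (just u))
                                     (non-positive ∘ positive-off-spine v~u)
        one-negative : ∀ {s t} → incidence v s < 0ℤ → incidence v t < 0ℤ → s ≡ t
        one-negative s<0 t<0 = just-injective (trans (sym (negative-to-next s<0)) (negative-to-next t<0))
        positive-to-w : sgn G v w ≡ just pos
        positive-to-w = positive-off-spine (Adj-sym w~v) λ next≡w →
          All.lookup w≢vr (there (head⇒∈ next≡w)) refl

mainTheorem3 : (D : ℤ → Set) → ¬ D -1ℤ →
               {n : ℕ} (T : SignedGraph n) → IsTree T → Realizes T D →
               (v : Fin n) → sdeg T v < 0ℤ →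
               ¬ Pendant T v × (∀ w → Adj T v w → ¬ LimitingPendant T w)
mainTheorem3 D -1∉D T (_ , acyclic) realizes v sdeg<0 = not-pendant , not-next-to-limiting
  where
  not-pendant : ¬ Pendant T v
  not-pendant pendant with sdeg-pendant T pendant
  ... | inj₁ sdeg≡1  = ℤ.<⇒≱ sdeg<0 (subst (0ℤ ≤ℤ_) (sym sdeg≡1) (+≤+ z≤n))
  ... | inj₂ sdeg≡-1 = sdeg≢-1 T D -1∉D realizes v sdeg≡-1
  not-next-to-limiting : ∀ w → Adj T v w → ¬ LimitingPendant T w
  not-next-to-limiting w v~w limiting with longestPath-from T limiting
  ... | [] , lp with () ← longestPath-neighbour T acyclic lp (Adj-sym T v~w)
  ... | _ ∷ _ , lp with refl ← longestPath-neighbour T acyclic lp (Adj-sym T v~w) =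
    ℤ.<⇒≱ sdeg<0 (longestPath-second-sdeg-nonneg T D -1∉D realizes acyclic lp)
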